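{- For every finite simplicial complex $X$, $\mathcal{C}(X)=1$ if and only if $\theta(X)=1$.
   Context: A simplicial complex $X$ on a finite set $V$ is a family of subsets of $V$ closed under taking subsets; its vertices are those $v$ with $\{v\}\in X$. For a vertex $v$, $\mathrm{del}(X;v)=\{S\in X:v\notin S\}$, $\mathrm{lk}(X;v)=\{T\in X:v\notin T,\ T\cup\{v\}\in X\}$; $v$ is a cone vertex if $\mathrm{lk}(X;v)=\mathrm{del}(X;v)$, and $V(X)^\circ$ is the set of non-cone vertices. Theta-number: $\theta(X)=0$ if $V(X)^\circ=\emptyset$, otherwise $\theta(X)=\min_{v\in V(X)^\circ}\max\{\theta(\mathrm{del}(X;v)),\theta(\mathrm{lk}(X;v))+1\}$. A face $A$ is free if it lies in a unique facet $B$; removing $[A,B]=\{C\in X:A\subseteq C\subseteq B\}$ is an elementary $k$-collapse if $|A|\le k$; the collapsibility number $\mathcal{C}(X)$ is the least $k$ such that $X$ can be reduced to the void complex (no faces) by elementary $k$-collapses. -}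

module Defs where

open import Data.Nat using (ℕ; zero; suc; _≤_; _⊔_; _⊓_)
open import Data.Bool using (Bool; true; false; _∧_; not; if_then_else_)
open import Data.Fin using (Fin)
open import Data.Fin.Subset using (Subset; _⊆_; ⁅_⁆; _∪_; ∣_∣)
open import Data.Vec using (Vec; []; _∷_; lookup)
open import Data.List using (List; []; _∷_; map; filter; foldr; _++_; allFin)
open import Data.Product using (_×_; Σ)
open import Relation.Binary.PropositionalEquality using (_≡_)
open import Relation.Nullary using (¬_)
open import Relation.Unary using (Decidable)
open import Relation.Nullary.Decidable using (yes; no)
open import Data.Bool.Properties using (T?)
open import Data.Bool using (T)

Family : ℕ → Set
Family n = Subset n → Bool

_∈F_ : ∀ {n} → Subset n → Family n → Set
S ∈F X = X S ≡ true

record SimplicialComplex (n : ℕ) : Set where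
  field
    face   : Family n
    closed : ∀ (S R : Subset n) → R ⊆ S → S ∈F face → R ∈F face
open SimplicialComplex public

allSubsets : (n : ℕ) → List (Subset n)
allSubsets zero    = [] ∷ []
allSubsets (suc n) = map (false ∷_) (allSubsets n) ++ map (true ∷_) (allSubsets n)

allB : ∀ {A : Set} → (A → Bool) → List A → Bool
allB p []       = true
allB p (x ∷ xs) = p x ∧ allB p xs

boolEq : Bool → Bool → Bool
boolEq true  b = b
boolEq false b = not b

memb : ∀ {n} → Fin n → Subset n → Bool
memb v S = lookup S v

del : ∀ {n} → Family n → Fin n → Family n
del X v S = not (memb v S) ∧ X S

lk : ∀ {n} → Family n → Fin n → Family n
lk X v T = not (memb v T) ∧ (X T ∧ X (T ∪ ⁅ v ⁆))

isVertex : ∀ {n} → Family n → Fin n → Bool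
isVertex X v = X ⁅ v ⁆

isCone : ∀ {n} → Family n → Fin n → Bool
isCone {n} X v = allB (λ T → boolEq (lk X v T) (del X v T)) (allSubsets n)

nonConeVertices : ∀ {n} → Family n → List (Fin n)
nonConeVertices {n} X =
  filter (λ v → T? (isVertex X v ∧ not (isCone X v))) (allFin n)

-- The recursion removes a vertex at each step
-- (v is a vertex of X but not of del(X;v) nor of lk(X;v)), so fuel
-- n = |V| is always sufficient; the fuel-0 clause is never reached
-- on a family with a non-cone vertex.

θ-aux : ∀ {n} → ℕ → Family n → ℕ
θ-aux zero    X = 0
θ-aux (suc f) X with nonConeVertices X
... | []     = 0
... | v ∷ vs = foldr _⊓_ (val v) (map val vs)
  where
  val : _ → ℕ
  val w = θ-aux f (del X w) ⊔ suc (θ-aux f (lk X w))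

θ : ∀ {n} → SimplicialComplex n → ℕ
θ {n} X = θ-aux n (face X)

IsFacet : ∀ {n} → Family n → Subset n → Set
IsFacet X B = B ∈F X × (∀ C → C ∈F X → B ⊆ C → C ≡ B)

FreeIn : ∀ {n} → Family n → Subset n → Subset n → Set
FreeIn X A B = A ∈F X × IsFacet X B × A ⊆ B
             × (∀ B′ → IsFacet X B′ → A ⊆ B′ → B′ ≡ B)

subsetB : ∀ {n} → Subset n → Subset n → Bool
subsetB []      []      = true
subsetB (a ∷ A) (b ∷ B) = (if a then b else true) ∧ subsetB A B

removeInterval : ∀ {n} → Family n → Subset n → Subset n → Family n
removeInterval X A B C = X C ∧ not (subsetB A C ∧ subsetB C B)

Void : ∀ {n} → Family n → Set
Void {n} X = ∀ (S : Subset n) → X S ≡ false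

data KCollapsible {n : ℕ} (k : ℕ) : Family n → Set where
  done : ∀ {X} → Void X → KCollapsible k X
  step : ∀ {X} (A B : Subset n) → FreeIn X A B → ∣ A ∣ ≤ k
       → KCollapsible k (removeInterval X A B) → KCollapsible k X

CollapsibilityNumberIs : ∀ {n} → SimplicialComplex n → ℕ → Set
CollapsibilityNumberIs X m =
  KCollapsible m (face X) × (∀ k → KCollapsible k (face X) → m ≤ k)

-- Complexes all of whose vertices are cone vertices are exactly the simplices and the void
-- complex, i.e. the 0-collapsible ones, and they are the ones with θ = 0.  A 1-collapse removes
-- either the empty face, possible only in a simplex, or a vertex w.  The face {w} is free exactly
-- when lk(X;w) is a simplex, i.e. θ(lk(X;w)) = 0, and removing its star leaves del(X;w); if w
-- is moreover a cone vertex, X itself is a simplex.  So the branch max{θ(del), θ(lk) + 1} ≤ 1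
-- of the definition of θ is precisely "collapse the free vertex w, then 1-collapse del(X;w)",
-- and induction on the number of vertices gives θ(X) ≤ 1 ⇔ X is 1-collapsible.  Finally
-- C(X) = 1 means 1-collapsible but not 0-collapsible, i.e. θ(X) ≤ 1 and θ(X) ≠ 0.

module Submission where

open import Defs
open import Data.Nat using (ℕ; zero; suc; _≤_; z≤n; s≤s; _⊔_; _⊓_)
open import Data.Nat.Properties
  using (≤-trans; ≤-refl; ≤-reflexive; ≤-antisym; n≢0⇒n>0; ≤-pred; <-≤-trans; n≮0;
         ⊓-sel; m≤n⇒m⊓o≤n; m≤n⇒o⊓m≤n;
         m≤m⊔n; m≤n⊔m; ⊔-lub; n≤0⇒n≡0)
open import Data.Bool using (Bool; true; false; _∧_; not; T; if_then_else_)
open import Data.Bool.Properties using (T?)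
open import Data.Unit using (tt)
open import Data.Fin using (Fin; zero; suc)
open import Data.Fin.Properties using (_≟_)
open import Data.Fin.Subset using (Subset; inside; outside; _∈_; _∉_; _⊆_; ⁅_⁆; _∪_; _-_; ⊥; ∣_∣)
open import Data.Fin.Subset.Properties
  using (_∈?_; ⊆-refl; ⊆-trans; ⊆-antisym; ⊥⊆; ∉⊥; ∈⊤; ∣⊤∣≡n; ∣⊥∣≡0; ∣⁅x⁆∣≡1; Empty-unique;
         x∈⁅x⁆; x∈⁅y⁆⇒x≡y; p⊆p∪q; q⊆p∪q; x∈p∪q⁻; drop-there; drop-∷-⊆; out⊆; in⊆in;
         x∈p∧x≢y⇒x∈p-y; p─q⊆p; x∈p⇒∣p-x∣<∣p∣)
open import Data.Vec using (_∷_; [])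
import Data.Vec.Base as Vec
open import Data.Vec.Properties using ([]=⇒lookup; lookup⇒[]=)
open import Data.List using (List; []; _∷_; map; foldr; allFin)
open import Data.List.Properties using (filter-none; foldr-preservesᵒ)
open import Data.List.Membership.Propositional using () renaming (_∈_ to _∈ᴸ_)
open import Data.List.Membership.Propositional.Properties
  using (∈-filter⁺; ∈-filter⁻; ∈-allFin; ∈-++⁺ˡ; ∈-++⁺ʳ; ∈-map⁺; ∈-map⁻; foldr-selective)
open import Data.List.Relation.Unary.Any using (Any; here; there)
import Data.List.Relation.Unary.Any as Any
import Data.List.Relation.Unary.All as All
open import Data.Product using (_×_; ∃-syntax; _,_; proj₁; proj₂)
open import Data.Sum using (_⊎_; inj₁; inj₂)
open import Data.Empty using (⊥-elim)
open import Function using (_∘_)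
open import Relation.Binary.PropositionalEquality using (_≡_; _≗_; refl; sym; trans; cong; subst)
open import Relation.Nullary using (¬_; yes; no; Dec; contradiction)
open import Relation.Unary using (Decidable)
open import Function.Bundles using (_⇔_; mk⇔; Equivalence)

private
  variable
    n k : ℕ
    v w : Fin n
    A B C S : Subset n
    X Y : Family n

∧-true⁻ : ∀ {x y} → x ∧ y ≡ true → x ≡ true × y ≡ true
∧-true⁻ {true} p = refl , p

∧-true⁺ : ∀ {x y} → x ≡ true → y ≡ true → x ∧ y ≡ true
∧-true⁺ refl refl = refl

true⇔⇒≡ : ∀ {x y} → (x ≡ true → y ≡ true) → (y ≡ true → x ≡ true) → x ≡ y
true⇔⇒≡ {true}           x⇒y _   = sym (x⇒y refl)
true⇔⇒≡ {false} {true}   _   y⇒x = y⇒x refl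
true⇔⇒≡ {false} {false}  _   _   = refl

T-∧-not : ∀ {x y} → x ≡ true → y ≡ false → T (x ∧ not y)
T-∧-not refl refl = tt

T-∧-not⁻ : ∀ {x y} → T (x ∧ not y) → x ≡ true × y ≡ false
T-∧-not⁻ {true} {false} _ = refl , refl

memb⇒∈ : memb v S ≡ true → v ∈ S
memb⇒∈ {v = v} {S = S} = lookup⇒[]= v S

not-memb⁺ : v ∉ S → not (memb v S) ≡ true
not-memb⁺ {v = v} {S = S} v∉S with memb v S in eq
... | true  = contradiction (memb⇒∈ eq) v∉S
... | false = refl

not-memb⁻ : not (memb v S) ≡ true → v ∉ S
not-memb⁻ p v∈S = contradiction (trans (cong not (sym ([]=⇒lookup v∈S))) p) λ ()

subsetB⇒⊆ : ∀ (A C : Subset n) → subsetB A C ≡ true → A ⊆ C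
subsetB⇒⊆ []             []             _ ()
subsetB⇒⊆ (inside  ∷ A) (inside  ∷ C) p = in⊆in (subsetB⇒⊆ A C p)
subsetB⇒⊆ (outside ∷ A) (_       ∷ C) p = out⊆ (subsetB⇒⊆ A C p)

⊆⇒subsetB : ∀ (A C : Subset n) → A ⊆ C → subsetB A C ≡ true
⊆⇒subsetB []             []             _   = refl
⊆⇒subsetB (inside  ∷ A) (inside  ∷ C) A⊆C = ⊆⇒subsetB A C (drop-∷-⊆ A⊆C)
⊆⇒subsetB (inside  ∷ A) (outside ∷ C) A⊆C with A⊆C Vec.here
... | ()
⊆⇒subsetB (outside ∷ A) (_       ∷ C) A⊆C = ⊆⇒subsetB A C (drop-∷-⊆ A⊆C)

x∈p⇒⁅x⁆⊆p : ∀ {x : Fin n} {p} → x ∈ p → ⁅ x ⁆ ⊆ p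
x∈p⇒⁅x⁆⊆p {x = x} {p} x∈p y∈⁅x⁆ = subst (_∈ p) (sym (x∈⁅y⁆⇒x≡y x y∈⁅x⁆)) x∈p

∪-least : A ⊆ C → B ⊆ C → A ∪ B ⊆ C
∪-least {A = A} {B = B} A⊆C B⊆C x∈A∪B with x∈p∪q⁻ A B x∈A∪B
... | inj₁ x∈A = A⊆C x∈A
... | inj₂ x∈B = B⊆C x∈B

x∉p-x : ∀ (x : Fin n) (p : Subset n) → x ∉ p - x
x∉p-x zero    (_ ∷ p) ()
x∉p-x (suc x) (_ ∷ p) x∈p-x = x∉p-x x p (drop-there x∈p-x)

p-x⊆p : ∀ (x : Fin n) (p : Subset n) → p - x ⊆ p
p-x⊆p x p = p─q⊆p p ⁅ x ⁆

p⊆p-x∪⁅x⁆ : ∀ (x : Fin n) (p : Subset n) → p ⊆ (p - x) ∪ ⁅ x ⁆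
p⊆p-x∪⁅x⁆ x p {y} y∈p with y ≟ x
... | yes refl = q⊆p∪q (p - x) ⁅ x ⁆ (x∈⁅x⁆ x)
... | no  y≢x  = p⊆p∪q ⁅ x ⁆ (x∈p∧x≢y⇒x∈p-y y∈p y≢x)

∣p∣≤0⇒p≡⊥ : ∀ (p : Subset n) → ∣ p ∣ ≤ 0 → p ≡ ⊥
∣p∣≤0⇒p≡⊥ p ∣p∣≤0 = Empty-unique λ (x , x∈p) → n≮0 (<-≤-trans (x∈p⇒∣p-x∣<∣p∣ x∈p) ∣p∣≤0)

∣p∣≤1⇒p≡⊥⊎p≡⁅x⁆ : ∀ (p : Subset n) → ∣ p ∣ ≤ 1 → p ≡ ⊥ ⊎ ∃[ x ] p ≡ ⁅ x ⁆
∣p∣≤1⇒p≡⊥⊎p≡⁅x⁆ []            _ = inj₁ refl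
∣p∣≤1⇒p≡⊥⊎p≡⁅x⁆ (inside  ∷ p) (s≤s ∣p∣≤0) = inj₂ (zero , cong (inside ∷_) (∣p∣≤0⇒p≡⊥ p ∣p∣≤0))
∣p∣≤1⇒p≡⊥⊎p≡⁅x⁆ (outside ∷ p) ∣p∣≤1 with ∣p∣≤1⇒p≡⊥⊎p≡⁅x⁆ p ∣p∣≤1
... | inj₁ p≡⊥       = inj₁ (cong (outside ∷_) p≡⊥)
... | inj₂ (x , p≡x) = inj₂ (suc x , cong (outside ∷_) p≡x)

∣p∣≤1+f⇒∣p-x∣≤f : ∀ {f} {x : Fin n} {p : Subset n} → x ∈ p → ∣ p ∣ ≤ suc f → ∣ p - x ∣ ≤ f
∣p∣≤1+f⇒∣p-x∣≤f x∈p ∣p∣≤1+f = ≤-pred (<-≤-trans (x∈p⇒∣p-x∣<∣p∣ x∈p) ∣p∣≤1+f)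

DownClosed : Family n → Set
DownClosed X = ∀ {S R} → R ⊆ S → S ∈F X → R ∈F X

del-∈⁺ : ∀ X → v ∉ S → S ∈F X → S ∈F del X v
del-∈⁺ X v∉S S∈X = ∧-true⁺ (not-memb⁺ v∉S) S∈X

del-∈⁻ : ∀ X → S ∈F del X v → v ∉ S × S ∈F X
del-∈⁻ X p = let v∉S , S∈X = ∧-true⁻ p in not-memb⁻ v∉S , S∈X

lk-∈⁺ : ∀ X → DownClosed X → v ∉ S → (S ∪ ⁅ v ⁆) ∈F X → S ∈F lk X v
lk-∈⁺ {v = v} X X↓ v∉S S+v∈X = ∧-true⁺ (not-memb⁺ v∉S) (∧-true⁺ (X↓ (p⊆p∪q ⁅ v ⁆) S+v∈X) S+v∈X)

lk-∈⁻ : ∀ X → S ∈F lk X v → v ∉ S × S ∈F X × (S ∪ ⁅ v ⁆) ∈F X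
lk-∈⁻ X p = let v∉S , q = ∧-true⁻ p ; S∈X , S+v∈X = ∧-true⁻ q in not-memb⁻ v∉S , S∈X , S+v∈X

del-downClosed : DownClosed X → DownClosed (del X v)
del-downClosed {X = X} X↓ R⊆S S∈del =
  let v∉S , S∈X = del-∈⁻ X S∈del in del-∈⁺ X (v∉S ∘ R⊆S) (X↓ R⊆S S∈X)

lk-downClosed : DownClosed X → DownClosed (lk X v)
lk-downClosed {X = X} {v = v} X↓ R⊆S S∈lk =
  let v∉S , _ , S+v∈X = lk-∈⁻ X S∈lk
  in lk-∈⁺ X X↓ (v∉S ∘ R⊆S) (X↓ (∪-least (⊆-trans R⊆S (p⊆p∪q ⁅ v ⁆)) (q⊆p∪q _ ⁅ v ⁆)) S+v∈X)

removeInterval-∈⁺ : ∀ X → C ∈F X → ¬ (A ⊆ C × C ⊆ B) → C ∈F removeInterval X A B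
removeInterval-∈⁺ {C = C} {A = A} {B = B} X C∈X ∉[A,B] with subsetB A C in A⊆C | subsetB C B in C⊆B
... | true  | true  = ⊥-elim (∉[A,B] (subsetB⇒⊆ A C A⊆C , subsetB⇒⊆ C B C⊆B))
... | true  | false = ∧-true⁺ C∈X refl
... | false | _     = ∧-true⁺ C∈X refl

removeInterval-∈⁻ : ∀ X → C ∈F removeInterval X A B → C ∈F X × ¬ (A ⊆ C × C ⊆ B)
removeInterval-∈⁻ {C = C} {A = A} {B = B} X p =
  let C∈X , ∉[A,B] = ∧-true⁻ p
  in C∈X , λ (A⊆C , C⊆B) → contradiction
       (trans (cong not (sym (∧-true⁺ (⊆⇒subsetB A C A⊆C) (⊆⇒subsetB C B C⊆B)))) ∉[A,B]) λ ()

removeInterval-void : (∀ {C} → C ∈F X → A ⊆ C × C ⊆ B) → Void (removeInterval X A B)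
removeInterval-void {X = X} {A = A} {B = B} in[A,B] C with X C in C∈X
... | false = refl
... | true  rewrite ⊆⇒subsetB A C (proj₁ (in[A,B] C∈X)) | ⊆⇒subsetB C B (proj₂ (in[A,B] C∈X)) = refl

IsConeVertex : Family n → Fin n → Set
IsConeVertex X v = ∀ {S} → S ∈F X → v ∉ S → (S ∪ ⁅ v ⁆) ∈F X

AllCone : Family n → Set
AllCone X = ∀ v → ⁅ v ⁆ ∈F X → IsConeVertex X v

∈-allSubsets : ∀ (S : Subset n) → S ∈ᴸ allSubsets n
∈-allSubsets []                      = here refl
∈-allSubsets {suc n} (outside ∷ S) = ∈-++⁺ˡ (∈-map⁺ (outside ∷_) (∈-allSubsets S))
∈-allSubsets {suc n} (inside  ∷ S) =
  ∈-++⁺ʳ (map (outside ∷_) (allSubsets n)) (∈-map⁺ (inside ∷_) (∈-allSubsets S))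

allB⁻ : ∀ {I : Set} {p : I → Bool} {xs x} → allB p xs ≡ true → x ∈ᴸ xs → p x ≡ true
allB⁻ {p = p} {x ∷ _} all (here refl) = proj₁ (∧-true⁻ {p x} all)
allB⁻ {p = p} {y ∷ _} all (there x∈) = allB⁻ (proj₂ (∧-true⁻ {p y} all)) x∈

allB⁺ : ∀ {I : Set} {p : I → Bool} xs → (∀ x → p x ≡ true) → allB p xs ≡ true
allB⁺ []       _   = refl
allB⁺ (x ∷ xs) all = ∧-true⁺ (all x) (allB⁺ xs all)

-- The test boolEq (lk X v S) (del X v S), with d = not (memb v S), x = X S, y = X (S ∪ ⁅ v ⁆).
coneTest⁻ : ∀ d x y → boolEq (d ∧ (x ∧ y)) (d ∧ x) ≡ true → d ≡ true → x ≡ true → y ≡ true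
coneTest⁻ true true true _ _ _ = refl

coneTest⁺ : ∀ d x y → (d ≡ true → x ≡ true → y ≡ true) → boolEq (d ∧ (x ∧ y)) (d ∧ x) ≡ true
coneTest⁺ false _     _ _ = refl
coneTest⁺ true  false _ _ = refl
coneTest⁺ true  true  y y-holds rewrite y-holds refl refl = refl

isCone⇒IsConeVertex : isCone X v ≡ true → IsConeVertex X v
isCone⇒IsConeVertex {X = X} {v = v} cone {S} S∈X v∉S =
  coneTest⁻ _ (X S) _ (allB⁻ {p = λ S → boolEq (lk X v S) (del X v S)} cone (∈-allSubsets S))
    (not-memb⁺ v∉S) S∈X

IsConeVertex⇒isCone : IsConeVertex X v → isCone X v ≡ true
IsConeVertex⇒isCone {n} {X = X} {v = v} cone =
  allB⁺ (allSubsets n) λ S → coneTest⁺ _ (X S) _ λ v∉S S∈X → cone S∈X (not-memb⁻ v∉S)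

isConeVertex? : ∀ (X : Family n) v → Dec (IsConeVertex X v)
isConeVertex? X v with isCone X v in eq
... | true  = yes (isCone⇒IsConeVertex eq)
... | false = no λ cone → contradiction (trans (sym eq) (IsConeVertex⇒isCone cone)) λ ()

cone-∪ : DownClosed X → IsConeVertex X v → S ∈F X → (S ∪ ⁅ v ⁆) ∈F X
cone-∪ {v = v} {S = S} X↓ cone S∈X with v ∈? S
... | yes v∈S = X↓ (∪-least ⊆-refl (x∈p⇒⁅x⁆⊆p v∈S)) S∈X
... | no  v∉S = cone S∈X v∉S

isNonConeVertex? : ∀ (X : Family n) → Decidable (λ v → T (isVertex X v ∧ not (isCone X v)))
isNonConeVertex? X v = T? (isVertex X v ∧ not (isCone X v))

∈-nonConeVertices⁺ : ⁅ v ⁆ ∈F X → ¬ IsConeVertex X v → v ∈ᴸ nonConeVertices X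
∈-nonConeVertices⁺ {v = v} {X = X} v∈X ¬cone with isCone X v in eq
... | true  = ⊥-elim (¬cone (isCone⇒IsConeVertex eq))
... | false = ∈-filter⁺ (isNonConeVertex? X) (∈-allFin v) (T-∧-not v∈X eq)

∈-nonConeVertices⁻ : v ∈ᴸ nonConeVertices X → ⁅ v ⁆ ∈F X × ¬ IsConeVertex X v
∈-nonConeVertices⁻ {n} {X = X} v∈ =
  let v∈X , notCone = T-∧-not⁻ (proj₂ (∈-filter⁻ (isNonConeVertex? X) {xs = allFin n} v∈))
  in v∈X , λ cone → contradiction (trans (sym notCone) (IsConeVertex⇒isCone cone)) λ ()

allCone⇒nonConeVertices≡[] : AllCone X → nonConeVertices X ≡ []
allCone⇒nonConeVertices≡[] {n} {X = X} allCone =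
  filter-none (isNonConeVertex? X) {xs = allFin n} (All.tabulate (λ {v} _ → notNonCone v))
  where
  notNonCone : ∀ v → ¬ T (isVertex X v ∧ not (isCone X v))
  notNonCone v nonCone =
    let v∈X , notCone = T-∧-not⁻ nonCone
    in contradiction (trans (sym notCone) (IsConeVertex⇒isCone (allCone v v∈X))) λ ()

nonConeVertices≡[]⇒allCone : nonConeVertices X ≡ [] → AllCone X
nonConeVertices≡[]⇒allCone {X = X} none v v∈X with isConeVertex? X v
... | yes cone = cone
... | no ¬cone with () ← subst (v ∈ᴸ_) none (∈-nonConeVertices⁺ v∈X ¬cone)

foldr-⊓-attained : ∀ {I : Set} (g : I → ℕ) x xs →
                   ∃[ y ] y ∈ᴸ x ∷ xs × foldr _⊓_ (g x) (map g xs) ≡ g y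
foldr-⊓-attained g x xs with foldr-selective ⊓-sel (g x) (map g xs)
... | inj₁ ≡gx = x , here refl , ≡gx
... | inj₂ ∈gxs with ∈-map⁻ g ∈gxs
...   | y , y∈xs , ≡gy = y , there y∈xs , ≡gy

foldr-⊓-≤ : ∀ {I : Set} (g : I → ℕ) x xs {y} → y ∈ᴸ x ∷ xs → foldr _⊓_ (g x) (map g xs) ≤ g y
foldr-⊓-≤ g x xs {y} y∈ = foldr-preservesᵒ ⊓-≤ (g x) (map g xs) (at y∈)
  where
  ⊓-≤ : ∀ a b → a ≤ g y ⊎ b ≤ g y → a ⊓ b ≤ g y
  ⊓-≤ a b (inj₁ a≤) = m≤n⇒m⊓o≤n b a≤
  ⊓-≤ a b (inj₂ b≤) = m≤n⇒o⊓m≤n a b≤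
  at : y ∈ᴸ x ∷ xs → g x ≤ g y ⊎ Any (_≤ g y) (map g xs)
  at (here refl)  = inj₁ ≤-refl
  at (there y∈xs) = inj₂ (Any.map (≤-reflexive ∘ sym) (∈-map⁺ g y∈xs))

-- Definitionally the quantity minimised over V(X)° in θ-aux (suc f).
θ-at : ℕ → Family n → Fin n → ℕ
θ-at f X w = θ-aux f (del X w) ⊔ suc (θ-aux f (lk X w))

θ-at-positive : ∀ f (X : Family n) w → 1 ≤ θ-at f X w
θ-at-positive f X w = ≤-trans (s≤s z≤n) (m≤n⊔m (θ-aux f (del X w)) _)

θ-at≤1⁺ : ∀ f → θ-aux f (del X w) ≤ 1 → θ-aux f (lk X w) ≡ 0 → θ-at f X w ≤ 1
θ-at≤1⁺ f del≤1 lk≡0 rewrite lk≡0 = ⊔-lub del≤1 ≤-refl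

θ-at≤1⁻ : ∀ f → θ-at f X w ≤ 1 → θ-aux f (del X w) ≤ 1 × θ-aux f (lk X w) ≡ 0
θ-at≤1⁻ {X = X} {w = w} f at≤1 =
  ≤-trans (m≤m⊔n _ _) at≤1 , n≤0⇒n≡0 (≤-pred (≤-trans (m≤n⊔m (θ-aux f (del X w)) _) at≤1))

θ-aux-allCone : ∀ f → AllCone X → θ-aux f X ≡ 0
θ-aux-allCone zero    _ = refl
θ-aux-allCone {X = X} (suc f) allCone with nonConeVertices X | allCone⇒nonConeVertices≡[] allCone
... | [] | refl = refl

allCone⇒θ-aux≤1 : ∀ f → AllCone X → θ-aux f X ≤ 1
allCone⇒θ-aux≤1 f allCone = ≤-trans (≤-reflexive (θ-aux-allCone f allCone)) z≤n

θ-aux-suc≡0⇒allCone : ∀ f → θ-aux (suc f) X ≡ 0 → AllCone X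
θ-aux-suc≡0⇒allCone {X = X} f θ≡0 with nonConeVertices X in none
... | []     = nonConeVertices≡[]⇒allCone none
... | v ∷ vs =
  let u , _ , ≡θ-at = foldr-⊓-attained (θ-at f X) v vs
  in ⊥-elim (n≮0 (subst (1 ≤_) (trans (sym ≡θ-at) θ≡0) (θ-at-positive f X u)))

θ-aux-suc≤1⁺ : ∀ f → w ∈ᴸ nonConeVertices X → θ-at f X w ≤ 1 → θ-aux (suc f) X ≤ 1
θ-aux-suc≤1⁺ {X = X} f w∈ at≤1 with nonConeVertices X
... | v ∷ vs = ≤-trans (foldr-⊓-≤ (θ-at f X) v vs w∈) at≤1

θ-aux-suc≤1⁻ : ∀ f → θ-aux (suc f) X ≤ 1 →
               AllCone X ⊎ ∃[ w ] w ∈ᴸ nonConeVertices X × θ-at f X w ≤ 1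
θ-aux-suc≤1⁻ {X = X} f θ≤1 with nonConeVertices X in none
... | []     = inj₁ (nonConeVertices≡[]⇒allCone none)
... | v ∷ vs =
  let u , u∈ , ≡θ-at = foldr-⊓-attained (θ-at f X) v vs
  in inj₂ (u , u∈ , subst (_≤ 1) ≡θ-at θ≤1)

saturate : Family n → List (Fin n) → Subset n → Subset n
saturate X []       S = S
saturate X (v ∷ vs) S = if X (S ∪ ⁅ v ⁆) then saturate X vs (S ∪ ⁅ v ⁆) else saturate X vs S

⊆-saturate : ∀ (X : Family n) vs S → S ⊆ saturate X vs S
⊆-saturate X []       S = ⊆-refl
⊆-saturate X (v ∷ vs) S with X (S ∪ ⁅ v ⁆)
... | true  = ⊆-trans (p⊆p∪q ⁅ v ⁆) (⊆-saturate X vs (S ∪ ⁅ v ⁆))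
... | false = ⊆-saturate X vs S

saturate-∈F : ∀ (X : Family n) vs → S ∈F X → saturate X vs S ∈F X
saturate-∈F X []                 S∈X = S∈X
saturate-∈F {S = S} X (v ∷ vs) S∈X with X (S ∪ ⁅ v ⁆) in S+v∈X
... | true  = saturate-∈F X vs S+v∈X
... | false = saturate-∈F X vs S∈X

saturate-maximal : DownClosed X → ∀ vs S → C ∈F X → saturate X vs S ⊆ C →
                   ∀ {v} → v ∈ᴸ vs → v ∈ C → v ∈ saturate X vs S
saturate-maximal {X = X} X↓ (v ∷ vs) S C∈X sat⊆C (here refl) v∈C with X (S ∪ ⁅ v ⁆) in S+v∈X
... | true  = ⊆-saturate X vs (S ∪ ⁅ v ⁆) (q⊆p∪q S ⁅ v ⁆ (x∈⁅x⁆ v))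
... | false =
  let S+v⊆C = ∪-least (⊆-trans (⊆-saturate X vs S) sat⊆C) (x∈p⇒⁅x⁆⊆p v∈C)
  in contradiction (trans (sym (X↓ S+v⊆C C∈X)) S+v∈X) λ ()
saturate-maximal {X = X} X↓ (u ∷ vs) S C∈X sat⊆C (there v∈vs) v∈C with X (S ∪ ⁅ u ⁆)
... | true  = saturate-maximal {X = X} X↓ vs (S ∪ ⁅ u ⁆) C∈X sat⊆C v∈vs v∈C
... | false = saturate-maximal {X = X} X↓ vs S C∈X sat⊆C v∈vs v∈C

facet-above : DownClosed X → S ∈F X → ∃[ F ] IsFacet X F × S ⊆ F
facet-above {n} {X = X} {S = S} X↓ S∈X =
  F , (saturate-∈F X (allFin n) S∈X , maximal) , ⊆-saturate X (allFin n) S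
  where
  F : Subset n
  F = saturate X (allFin n) S
  maximal : ∀ C → C ∈F X → F ⊆ C → C ≡ F
  maximal C C∈X F⊆C =
    ⊆-antisym (λ {v} → saturate-maximal {X = X} X↓ (allFin n) S C∈X F⊆C (∈-allFin v)) F⊆C

free⇒star⊆ : DownClosed X → FreeIn X A B → S ∈F X → A ⊆ S → S ⊆ B
free⇒star⊆ {S = S} X↓ (_ , _ , _ , unique) S∈X A⊆S with facet-above X↓ S∈X
... | F , F-facet , S⊆F = subst (S ⊆_) (unique F F-facet (⊆-trans A⊆S S⊆F)) S⊆F

star⊆⇒free : DownClosed X → B ∈F X → A ⊆ B → (∀ {S} → S ∈F X → A ⊆ S → S ⊆ B) → FreeIn X A B
star⊆⇒free {X = X} {B = B} {A = A} X↓ B∈X A⊆B star⊆ =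
  X↓ A⊆B B∈X , (B∈X , maximal) , A⊆B , unique
  where
  maximal : ∀ C → C ∈F X → B ⊆ C → C ≡ B
  maximal C C∈X B⊆C = ⊆-antisym (star⊆ C∈X (⊆-trans A⊆B B⊆C)) B⊆C
  unique : ∀ B′ → IsFacet X B′ → A ⊆ B′ → B′ ≡ B
  unique B′ (B′∈X , B′-maximal) A⊆B′ = sym (B′-maximal B B∈X (star⊆ B′∈X A⊆B′))

IsSimplex : Family n → Subset n → Set
IsSimplex X B = B ∈F X × (∀ {S} → S ∈F X → S ⊆ B)

simplex⇒allCone : DownClosed X → IsSimplex X B → AllCone X
simplex⇒allCone X↓ (B∈X , ⊆B) v v∈X S∈X _ = X↓ (∪-least (⊆B S∈X) (⊆B v∈X)) B∈X

allCone⇒simplex : DownClosed X → AllCone X → ⊥ ∈F X → ∃[ B ] IsSimplex X B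
allCone⇒simplex X↓ allCone ⊥∈X with facet-above X↓ ⊥∈X
... | F , (F∈X , F-maximal) , _ = F , F∈X , λ S∈X {v} v∈S →
  let v∈X   = X↓ (x∈p⇒⁅x⁆⊆p v∈S) S∈X
      F+v≡F = F-maximal (F ∪ ⁅ v ⁆) (cone-∪ X↓ (allCone v v∈X) F∈X) (p⊆p∪q ⁅ v ⁆)
  in subst (v ∈_) F+v≡F (q⊆p∪q F ⁅ v ⁆ (x∈⁅x⁆ v))

IsFacet-resp : X ≗ Y → IsFacet X B → IsFacet Y B
IsFacet-resp {B = B} X≗Y (B∈X , maximal) =
  trans (sym (X≗Y B)) B∈X , λ C C∈Y → maximal C (trans (X≗Y C) C∈Y)

FreeIn-resp : X ≗ Y → FreeIn X A B → FreeIn Y A B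
FreeIn-resp {A = A} X≗Y (A∈X , facet , A⊆B , unique) =
  trans (sym (X≗Y A)) A∈X , IsFacet-resp X≗Y facet , A⊆B , λ B′ → unique B′ ∘ IsFacet-resp (sym ∘ X≗Y)

KCollapsible-resp : X ≗ Y → KCollapsible k X → KCollapsible k Y
KCollapsible-resp X≗Y (done void)              = done λ S → trans (sym (X≗Y S)) (void S)
KCollapsible-resp X≗Y (step A B free ∣A∣≤k rest) =
  step A B (FreeIn-resp X≗Y free) ∣A∣≤k (KCollapsible-resp (λ S → cong (λ b → b ∧ _) (X≗Y S)) rest)

KCollapsible-mono : ∀ {k m} → k ≤ m → KCollapsible k X → KCollapsible m X
KCollapsible-mono k≤m (done void)              = done void
KCollapsible-mono k≤m (step A B free ∣A∣≤k rest) =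
  step A B free (≤-trans ∣A∣≤k k≤m) (KCollapsible-mono k≤m rest)

void⇒allCone : Void X → AllCone X
void⇒allCone void v v∈X = contradiction (trans (sym v∈X) (void ⁅ v ⁆)) λ ()

simplex⇒0-collapsible : DownClosed X → IsSimplex X B → KCollapsible 0 X
simplex⇒0-collapsible {n} {B = B} X↓ (B∈X , ⊆B) =
  step ⊥ B (star⊆⇒free X↓ B∈X ⊥⊆ (λ S∈X _ → ⊆B S∈X)) (≤-reflexive (∣⊥∣≡0 n))
    (done (removeInterval-void λ C∈X → ⊥⊆ , ⊆B C∈X))

allCone⇒0-collapsible : DownClosed X → AllCone X → KCollapsible 0 X
allCone⇒0-collapsible {X = X} X↓ allCone with X ⊥ in ⊥∈X
... | true  = simplex⇒0-collapsible X↓ (proj₂ (allCone⇒simplex X↓ allCone ⊥∈X))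
... | false = done void
  where
  void : Void X
  void S with X S in S∈X
  ... | true  = contradiction (trans (sym (X↓ ⊥⊆ S∈X)) ⊥∈X) λ ()
  ... | false = refl

free-⊥⇒simplex : DownClosed X → FreeIn X ⊥ B → IsSimplex X B
free-⊥⇒simplex X↓ free@(_ , (B∈X , _) , _) = B∈X , λ S∈X → free⇒star⊆ X↓ free S∈X ⊥⊆

0-collapsible⇒allCone : DownClosed X → KCollapsible 0 X → AllCone X
0-collapsible⇒allCone X↓ (done void) = void⇒allCone void
0-collapsible⇒allCone X↓ (step A B free ∣A∣≤0 _) with refl ← ∣p∣≤0⇒p≡⊥ A ∣A∣≤0 =
  simplex⇒allCone X↓ (free-⊥⇒simplex X↓ free)

free-cone⇒simplex : DownClosed X → IsConeVertex X w → FreeIn X ⁅ w ⁆ B → IsSimplex X B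
free-cone⇒simplex {w = w} X↓ cone free@(_ , (B∈X , _) , _) =
  B∈X , λ S∈X → ⊆-trans (p⊆p∪q ⁅ w ⁆) (free⇒star⊆ X↓ free (cone-∪ X↓ cone S∈X) (q⊆p∪q _ ⁅ w ⁆))

free-vertex-link : DownClosed X → FreeIn X ⁅ w ⁆ B → IsSimplex (lk X w) (B - w)
free-vertex-link {X = X} {w = w} {B = B} X↓ free@(_ , (B∈X , _) , w⊆B , _) =
  lk-∈⁺ X X↓ (x∉p-x w B) (X↓ (∪-least (p-x⊆p w B) w⊆B) B∈X) , ⊆B-w
  where
  ⊆B-w : ∀ {S} → S ∈F lk X w → S ⊆ B - w
  ⊆B-w {S} S∈lk {v} v∈S =
    let w∉S , _ , S+w∈X = lk-∈⁻ X S∈lk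
        S+w⊆B = free⇒star⊆ X↓ free S+w∈X (q⊆p∪q S ⁅ w ⁆)
    in x∈p∧x≢y⇒x∈p-y (S+w⊆B (p⊆p∪q ⁅ w ⁆ v∈S)) λ { refl → w∉S v∈S }

free-vertex-del : DownClosed X → FreeIn X ⁅ w ⁆ B → removeInterval X ⁅ w ⁆ B ≗ del X w
free-vertex-del {X = X} {w = w} X↓ free C = true⇔⇒≡ to from
  where
  to : C ∈F removeInterval X ⁅ w ⁆ _ → C ∈F del X w
  to C∈ =
    let C∈X , ∉[w,B] = removeInterval-∈⁻ X C∈
    in del-∈⁺ X (λ w∈C → ∉[w,B] (x∈p⇒⁅x⁆⊆p w∈C , free⇒star⊆ X↓ free C∈X (x∈p⇒⁅x⁆⊆p w∈C)))
         C∈X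
  from : C ∈F del X w → C ∈F removeInterval X ⁅ w ⁆ _
  from C∈del =
    let w∉C , C∈X = del-∈⁻ X C∈del
    in removeInterval-∈⁺ X C∈X λ in[w,B] → w∉C (proj₁ in[w,B] (x∈⁅x⁆ w))

link-simplex⇒free : DownClosed X → IsSimplex (lk X w) B → FreeIn X ⁅ w ⁆ (B ∪ ⁅ w ⁆)
link-simplex⇒free {X = X} {w = w} {B = B} X↓ (B∈lk , ⊆B) =
  star⊆⇒free X↓ (proj₂ (proj₂ (lk-∈⁻ X B∈lk))) (q⊆p∪q B ⁅ w ⁆) star⊆
  where
  star⊆ : ∀ {S} → S ∈F X → ⁅ w ⁆ ⊆ S → S ⊆ B ∪ ⁅ w ⁆
  star⊆ {S} S∈X w⊆S =
    let S-w∈lk = lk-∈⁺ X X↓ (x∉p-x w S) (X↓ (∪-least (p-x⊆p w S) w⊆S) S∈X)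
    in ⊆-trans (p⊆p-x∪⁅x⁆ w S) (∪-least (⊆-trans (⊆B S-w∈lk) (p⊆p∪q ⁅ w ⁆)) (q⊆p∪q B ⁅ w ⁆))

link-allCone⇒free : DownClosed X → ⁅ w ⁆ ∈F X → AllCone (lk X w) → ∃[ B ] FreeIn X ⁅ w ⁆ B
link-allCone⇒free {X = X} {w = w} X↓ w∈X lk-allCone =
  let ⊥∈lk = lk-∈⁺ X X↓ ∉⊥ (X↓ (∪-least ⊥⊆ ⊆-refl) w∈X)
      B , simplex = allCone⇒simplex (lk-downClosed X↓) lk-allCone ⊥∈lk
  in B ∪ ⁅ w ⁆ , link-simplex⇒free X↓ simplex

lk⊆del : S ∈F lk X w → S ∈F del X w
lk⊆del {X = X} S∈lk = let w∉S , S∈X , _ = lk-∈⁻ X S∈lk in del-∈⁺ X w∉S S∈X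

VerticesWithin : Family n → Subset n → Set
VerticesWithin X S = ∀ {v} → ⁅ v ⁆ ∈F X → v ∈ S

del-verticesWithin : VerticesWithin X S → VerticesWithin (del X w) (S - w)
del-verticesWithin {X = X} within v∈del =
  let w∉v , v∈X = del-∈⁻ X v∈del in x∈p∧x≢y⇒x∈p-y (within v∈X) λ { refl → w∉v (x∈⁅x⁆ _) }

lk-verticesWithin : VerticesWithin X S → VerticesWithin (lk X w) (S - w)
lk-verticesWithin {X = X} within = del-verticesWithin {X = X} within ∘ lk⊆del {X = X}

-- θ-aux only computes θ when the fuel bounds the number of vertices; both del X w and lk X w
-- lose the vertex w, so the bound is kept along the recursion.
θ-aux≡0⇒allCone : ∀ f → VerticesWithin X S → ∣ S ∣ ≤ f → θ-aux f X ≡ 0 → AllCone X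
θ-aux≡0⇒allCone zero    within ∣S∣≤0 _ v v∈X =
  ⊥-elim (n≮0 (<-≤-trans (x∈p⇒∣p-x∣<∣p∣ (within v∈X)) ∣S∣≤0))
θ-aux≡0⇒allCone (suc f) _      _     θ≡0   = θ-aux-suc≡0⇒allCone f θ≡0

1-collapsible⇒θ-aux≤1 : ∀ f → DownClosed X → KCollapsible 1 X → θ-aux f X ≤ 1
1-collapsible⇒θ-aux≤1 zero    _  _ = z≤n
1-collapsible⇒θ-aux≤1 (suc f) X↓ (done void) = allCone⇒θ-aux≤1 (suc f) (void⇒allCone void)
1-collapsible⇒θ-aux≤1 {X = X} (suc f) X↓ (step A B free ∣A∣≤1 rest) with ∣p∣≤1⇒p≡⊥⊎p≡⁅x⁆ A ∣A∣≤1
... | inj₁ refl = allCone⇒θ-aux≤1 (suc f) (simplex⇒allCone X↓ (free-⊥⇒simplex X↓ free))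
... | inj₂ (w , refl) with isConeVertex? X w
...   | yes cone = allCone⇒θ-aux≤1 (suc f) (simplex⇒allCone X↓ (free-cone⇒simplex X↓ cone free))
...   | no ¬cone = θ-aux-suc≤1⁺ f (∈-nonConeVertices⁺ (proj₁ free) ¬cone) (θ-at≤1⁺ f del≤1 lk≡0)
  where
  del≤1 : θ-aux f (del X w) ≤ 1
  del≤1 = 1-collapsible⇒θ-aux≤1 f (del-downClosed X↓) (KCollapsible-resp (free-vertex-del X↓ free) rest)
  lk≡0 : θ-aux f (lk X w) ≡ 0
  lk≡0 = θ-aux-allCone f (simplex⇒allCone (lk-downClosed X↓) (free-vertex-link X↓ free))

θ-aux≤1⇒1-collapsible : ∀ f → DownClosed X → VerticesWithin X S → ∣ S ∣ ≤ f →
                        θ-aux f X ≤ 1 → KCollapsible 1 X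
θ-aux≤1⇒1-collapsible zero X↓ within ∣S∣≤0 _ =
  KCollapsible-mono z≤n (allCone⇒0-collapsible X↓ (θ-aux≡0⇒allCone zero within ∣S∣≤0 refl))
θ-aux≤1⇒1-collapsible {X = X} (suc f) X↓ within ∣S∣≤1+f θ≤1 with θ-aux-suc≤1⁻ f θ≤1
... | inj₁ allCone = KCollapsible-mono z≤n (allCone⇒0-collapsible X↓ allCone)
... | inj₂ (w , w∈ , at≤1) =
  let w∈X , _       = ∈-nonConeVertices⁻ w∈
      del≤1 , lk≡0  = θ-at≤1⁻ f at≤1
      ∣S-w∣≤f       = ∣p∣≤1+f⇒∣p-x∣≤f (within w∈X) ∣S∣≤1+f
      lk-allCone    = θ-aux≡0⇒allCone f (lk-verticesWithin {X = X} within) ∣S-w∣≤f lk≡0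
      B , free      = link-allCone⇒free X↓ w∈X lk-allCone
      del-collapses = θ-aux≤1⇒1-collapsible f (del-downClosed X↓)
                        (del-verticesWithin {X = X} within) ∣S-w∣≤f del≤1
  in step ⁅ w ⁆ B free (≤-reflexive (∣⁅x⁆∣≡1 w))
       (KCollapsible-resp (sym ∘ free-vertex-del X↓ free) del-collapses)

face-downClosed : ∀ (X : SimplicialComplex n) → DownClosed (face X)
face-downClosed X {S} {R} = closed X S R

θ≡0⇔0-collapsible : ∀ (X : SimplicialComplex n) → θ X ≡ 0 ⇔ KCollapsible 0 (face X)
θ≡0⇔0-collapsible {n} X = mk⇔
  (allCone⇒0-collapsible (face-downClosed X) ∘ θ-aux≡0⇒allCone n (λ _ → ∈⊤) (≤-reflexive (∣⊤∣≡n n)))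
  (θ-aux-allCone n ∘ 0-collapsible⇒allCone (face-downClosed X))

θ≤1⇔1-collapsible : ∀ (X : SimplicialComplex n) → θ X ≤ 1 ⇔ KCollapsible 1 (face X)
θ≤1⇔1-collapsible {n} X = mk⇔
  (θ-aux≤1⇒1-collapsible n (face-downClosed X) (λ _ → ∈⊤) (≤-reflexive (∣⊤∣≡n n)))
  (1-collapsible⇒θ-aux≤1 n (face-downClosed X))

corollary26 : ∀ (n : ℕ) (X : SimplicialComplex n) →
    CollapsibilityNumberIs X 1 ⇔ θ X ≡ 1
corollary26 n X = mk⇔ number⇒θ θ⇒number
  where
  module θ≤1 = Equivalence (θ≤1⇔1-collapsible X)
  module θ≡0 = Equivalence (θ≡0⇔0-collapsible X)
  number⇒θ : CollapsibilityNumberIs X 1 → θ X ≡ 1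
  number⇒θ (1-collapsible , least) =
    ≤-antisym (θ≤1.from 1-collapsible) (n≢0⇒n>0 λ θ≡0 → n≮0 (least 0 (θ≡0.to θ≡0)))
  θ⇒number : θ X ≡ 1 → CollapsibilityNumberIs X 1
  θ⇒number θ≡1 = θ≤1.to (≤-reflexive θ≡1) , least
    where
    least : ∀ k → KCollapsible k (face X) → 1 ≤ k
    least zero    0-collapsible = contradiction (trans (sym θ≡1) (θ≡0.from 0-collapsible)) λ ()
    least (suc k) _             = s≤s z≤n
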